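{- Let $S$ be a numerical semigroup, let $u \in \operatorname{MED}(S)$, and let $S_u$ be the submonoid of $\mathbb{Z}_{\geq 0}$ generated by $S \cup \{u\}$. Then $\operatorname{MED}(S_u)=\operatorname{MED}(S)$.
   Context: A numerical semigroup is an additive submonoid $S \subseteq \mathbb{Z}_{\geq 0}$ with $\mathbb{Z}_{\geq 0}\setminus S$ finite. Its multiplicity $m(S)$ is the smallest nonzero element of $S$, and its embedding dimension $e(S)$ is the cardinality of its (unique) minimal generating set. $S$ is a maximal embedding dimension (MED) semigroup if $e(S)=m(S)$. For a numerical semigroup $S$, $\operatorname{MED}(S)$ (the MED closure of $S$) denotes the smallest (with respect to inclusion) MED numerical semigroup $T$ with $S \subseteq T$ and $m(T)=m(S)$; it exists and equals the intersection of all MED numerical semigroups $T \supseteq S$ with $m(T)=m(S)$. -}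

module Defs where

open import Data.Nat using (ℕ; zero; suc; _+_; _≤_; _<_)
open import Data.List using (List; length)
open import Data.List.Membership.Propositional using (_∈_)
open import Data.List.Relation.Unary.Unique.Propositional using (Unique)
open import Data.Product using (Σ; _×_; _,_)
open import Data.Sum using (_⊎_)
open import Relation.Nullary using (¬_)
open import Relation.Binary.PropositionalEquality using (_≡_; _≢_)
open import Function.Bundles using (_⇔_)

Subset : Set₁
Subset = ℕ → Set

data Generated (A : Subset) : Subset where
  gen-zero : Generated A 0
  gen-inj  : ∀ {x} → A x → Generated A x
  gen-plus : ∀ {x y} → Generated A x → Generated A y → Generated A (x + y)

record IsNumericalSemigroup (S : Subset) : Set where
  field
    has-zero   : S 0
    closed-+   : ∀ {x y} → S x → S y → S (x + y)
    cofinite   : Σ ℕ λ N → ∀ n → N ≤ n → S n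

IsMultiplicity : Subset → ℕ → Set
IsMultiplicity S m = S m × 0 < m × (∀ x → S x → 0 < x → m ≤ x)

IsMinimalGeneratingList : Subset → List ℕ → Set
IsMinimalGeneratingList S G =
  Unique G
  × (∀ x → S x ⇔ Generated (λ y → y ∈ G) x)
  × (∀ g → g ∈ G → ¬ Generated (λ y → y ∈ G × y ≢ g) g)

HasEmbeddingDimension : Subset → ℕ → Set
HasEmbeddingDimension S e =
  Σ (List ℕ) λ G → IsMinimalGeneratingList S G × length G ≡ e

IsMED : Subset → Set
IsMED S = Σ ℕ λ m → IsMultiplicity S m × HasEmbeddingDimension S m

MEDClosure : Subset → ℕ → Set₁
MEDClosure S x =
  (T : Subset) → IsNumericalSemigroup T → IsMED T
  → (∀ y → S y → T y)
  → (Σ ℕ λ m → IsMultiplicity S m × IsMultiplicity T m)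
  → T x

Adjoin : Subset → ℕ → Subset
Adjoin S u = Generated (λ x → S x ⊎ x ≡ u)

{-# OPTIONS --safe #-}
-- MED(S) is contained in the ordinary semigroup {0} ∪ [m(S), ∞), which is MED with minimal
-- generators m(S), …, 2m(S) − 1. Hence u = 0 or u ≥ m(S), so m(S_u) = m(S); and every MED
-- semigroup T ⊇ S with m(T) = m(S) contains u, hence S_u. So MED(S) and MED(S_u) are
-- intersections of the same family.
-- Since S is an arbitrary predicate, m(S) only exists up to double negation; this is harmless
-- because a MED semigroup is finitely generated, so membership in it is decidable.
module Submission where

open import Defs
open import Data.Nat using (ℕ; zero; suc; _+_; _∸_; _≤_; _<_; z<s; _≟_; _<?_; _≤?_)
open import Data.Nat.Properties
open import Data.Nat.Induction using (<-rec)
open import Data.List using (List; applyUpTo)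
open import Data.List.Properties using (length-applyUpTo)
open import Data.List.Membership.Propositional using (_∈_; find; lose)
open import Data.List.Membership.Propositional.Properties using (∈-applyUpTo⁺; ∈-applyUpTo⁻)
open import Data.List.Relation.Unary.Any as Any using (Any; any?)
open import Data.List.Relation.Unary.Unique.Propositional.Properties using (applyUpTo⁺₁)
open import Data.Empty using (⊥)
open import Data.Product using (Σ; _×_; _,_; proj₁; proj₂)
open import Data.Sum using (_⊎_; inj₁; inj₂; [_,_])
open import Function using (_∘_)
open import Function.Bundles using (_⇔_; mk⇔; Equivalence)
open import Relation.Binary.PropositionalEquality using (_≡_; _≢_; refl; sym; subst)
open import Relation.Nullary using (¬_; Dec; yes; no; contradiction)
open import Relation.Nullary.Decidable using (map′; _⊎-dec_; decidable-stable)
open import Relation.Nullary.Negation using (¬¬-map)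
open import Relation.Unary using (Decidable; _⊆′_)

module _ {A : Subset} where

  Generated-least : ∀ {T} → IsNumericalSemigroup T → A ⊆′ T → Generated A ⊆′ T
  Generated-least nsT A⊆T _ gen-zero = IsNumericalSemigroup.has-zero nsT
  Generated-least nsT A⊆T _ (gen-inj a) = A⊆T _ a
  Generated-least nsT A⊆T _ (gen-plus p q) =
    IsNumericalSemigroup.closed-+ nsT (Generated-least nsT A⊆T _ p) (Generated-least nsT A⊆T _ q)

  least∈generators : ∀ {x} → Generated A x → 0 < x →
                     (∀ y → Generated A y → 0 < y → x ≤ y) → A x
  least∈generators (gen-inj a) _ _ = a
  least∈generators (gen-plus {zero} _ q) 0<x least = least∈generators q 0<x least
  least∈generators (gen-plus {suc x} {zero} p _) 0<x least rewrite +-identityʳ x =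
    least∈generators p 0<x least
  least∈generators (gen-plus {suc x} {suc _} p _) _ least =
    contradiction (least (suc x) p z<s) (<⇒≱ (m<m+n (suc x) z<s))

  generated-from-≥ : ∀ {m z} → (∀ {y} → A y → m ≤ y) →
                     Generated A z → z ≡ 0 ⊎ A z ⊎ m + m ≤ z
  generated-from-≥ A≥m gen-zero = inj₁ refl
  generated-from-≥ A≥m (gen-inj a) = inj₂ (inj₁ a)
  generated-from-≥ {m} A≥m (gen-plus {x} p q)
    with generated-from-≥ A≥m p | generated-from-≥ A≥m q
  ... | inj₁ refl | r = r
  ... | l | inj₁ refl rewrite +-identityʳ x = l
  ... | inj₂ l | inj₂ r = inj₂ (inj₂ (+-mono-≤ (atLeast l) (atLeast r)))
    where
    atLeast : ∀ {z} → A z ⊎ m + m ≤ z → m ≤ z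
    atLeast = [ A≥m , ≤-trans (m≤m+n m m) ]

IsMultiplicity-⊆ : ∀ {S S′ m} → S ⊆′ S′ → S m → IsMultiplicity S′ m → IsMultiplicity S m
IsMultiplicity-⊆ S⊆S′ Sm (_ , 0<m , least) = Sm , 0<m , λ y Sy → least y (S⊆S′ y Sy)

¬¬-multiplicity : ∀ {S n} → S n → 0 < n → ¬ ¬ Σ ℕ (IsMultiplicity S)
¬¬-multiplicity {S} {n} Sn 0<n ¬mult = noPositive n Sn 0<n
  where
  noPositive : ∀ k → S k → 0 < k → ⊥
  noPositive = <-rec _ λ k below Sk 0<k →
    ¬mult (k , Sk , 0<k , λ i Si 0<i → ≮⇒≥ λ i<k → below i<k Si 0<i)

module _ (G : List ℕ) where

  private
    ⟨G⟩ : Subset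
    ⟨G⟩ = Generated (_∈ G)

  Peels : ℕ → ℕ → Set
  Peels x g = 0 < g × g ≤ x × ⟨G⟩ (x ∸ g)

  generated⇒peels : ∀ {x} → ⟨G⟩ x → x ≡ 0 ⊎ Any (Peels x) G
  generated⇒peels gen-zero = inj₁ refl
  generated⇒peels (gen-inj {zero} _) = inj₁ refl
  generated⇒peels (gen-inj {suc x} g∈G) =
    inj₂ (lose g∈G (z<s , ≤-refl , subst ⟨G⟩ (sym (n∸n≡0 x)) gen-zero))
  generated⇒peels (gen-plus {x} {y} p q) with generated⇒peels p
  ... | inj₁ refl = generated⇒peels q
  ... | inj₂ peels = inj₂ (Any.map extend peels)
    where
    extend : ∀ {g} → Peels x g → Peels (x + y) g
    extend (0<g , g≤x , r) =
      0<g , ≤-trans g≤x (m≤m+n x y) , subst ⟨G⟩ (sym (+-∸-comm y g≤x)) (gen-plus r q)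

  peels⇒generated : ∀ {x} → Any (Peels x) G → ⟨G⟩ x
  peels⇒generated peels with g , g∈G , _ , g≤x , r ← find peels =
    subst ⟨G⟩ (m+[n∸m]≡n g≤x) (gen-plus (gen-inj g∈G) r)

  Generated-dec : Decidable ⟨G⟩
  Generated-dec = <-rec _ λ x below →
    map′ [ (λ { refl → gen-zero }) , peels⇒generated ] generated⇒peels
         (x ≟ 0 ⊎-dec any? (peels? below) G)
    where
    peels? : ∀ {x} → (∀ {y} → y < x → Dec (⟨G⟩ y)) → Decidable (Peels x)
    peels? {x} below g with 0 <? g | g ≤? x
    ... | no 0≮g | _ = no (0≮g ∘ proj₁)
    ... | yes _ | no g≰x = no (g≰x ∘ proj₁ ∘ proj₂)
    ... | yes 0<g | yes g≤x =
      map′ (λ r → 0<g , g≤x , r) (proj₂ ∘ proj₂) (below (∸-monoʳ-< 0<g g≤x))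

IsMED-dec : ∀ {T} → IsMED T → Decidable T
IsMED-dec (_ , _ , G , (_ , T⇔⟨G⟩ , _) , _) x =
  map′ (Equivalence.from (T⇔⟨G⟩ x)) (Equivalence.to (T⇔⟨G⟩ x)) (Generated-dec G x)

Ordinary : ℕ → Subset
Ordinary m n = n ≡ 0 ⊎ m ≤ n

ordinaryGenerators : ℕ → List ℕ
ordinaryGenerators m = applyUpTo (m +_) m

module _ {m : ℕ} where

  Ordinary-isNumericalSemigroup : IsNumericalSemigroup (Ordinary m)
  Ordinary-isNumericalSemigroup = record
    { has-zero = inj₁ refl
    ; closed-+ = closed-+
    ; cofinite = m , λ _ → inj₂
    }
    where
    closed-+ : ∀ {x y} → Ordinary m x → Ordinary m y → Ordinary m (x + y)
    closed-+ (inj₁ refl) y∈ = y∈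
    closed-+ {x} {y} (inj₂ m≤x) _ = inj₂ (≤-trans m≤x (m≤m+n x y))

  Ordinary-multiplicity : 0 < m → IsMultiplicity (Ordinary m) m
  Ordinary-multiplicity 0<m = inj₂ ≤-refl , 0<m , λ { _ (inj₁ refl) () ; _ (inj₂ m≤x) _ → m≤x }

  ordinaryGenerator-bounds : ∀ {g} → g ∈ ordinaryGenerators m → m ≤ g × g < m + m
  ordinaryGenerator-bounds g∈ with i , i<m , refl ← ∈-applyUpTo⁻ (m +_) g∈ =
    m≤m+n m i , +-monoʳ-< m i<m

  Ordinary⊆generated : 0 < m → Ordinary m ⊆′ Generated (_∈ ordinaryGenerators m)
  Ordinary⊆generated 0<m _ (inj₁ refl) = gen-zero
  Ordinary⊆generated 0<m x (inj₂ m≤x) = <-rec (λ x → m ≤ x → Generated _ x) step x m≤x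
    where
    step : ∀ x → (∀ {y} → y < x → m ≤ y → Generated (_∈ ordinaryGenerators m) y) →
           m ≤ x → Generated (_∈ ordinaryGenerators m) x
    step x below m≤x with m ≤? x ∸ m
    ... | yes m≤x∸m = subst (Generated _) (m+[n∸m]≡n m≤x)
      (gen-plus (gen-inj (subst (_∈ ordinaryGenerators m) (+-identityʳ m) (∈-applyUpTo⁺ (m +_) 0<m)))
                (below (∸-monoʳ-< 0<m m≤x) m≤x∸m))
    ... | no m≰x∸m = gen-inj (subst (_∈ ordinaryGenerators m) (m+[n∸m]≡n m≤x) (∈-applyUpTo⁺ (m +_) (≰⇒> m≰x∸m)))

  ordinaryGenerators-minimal : 0 < m → ∀ g → g ∈ ordinaryGenerators m →
    ¬ Generated (λ y → y ∈ ordinaryGenerators m × y ≢ g) g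
  ordinaryGenerators-minimal 0<m g g∈ p
    with generated-from-≥ (proj₁ ∘ ordinaryGenerator-bounds ∘ proj₁) p
  ... | inj₁ refl = <⇒≱ 0<m (proj₁ (ordinaryGenerator-bounds g∈))
  ... | inj₂ (inj₁ (_ , g≢g)) = g≢g refl
  ... | inj₂ (inj₂ m+m≤g) = <⇒≱ (proj₂ (ordinaryGenerator-bounds g∈)) m+m≤g

  Ordinary-isMED : 0 < m → IsMED (Ordinary m)
  Ordinary-isMED 0<m = m , Ordinary-multiplicity 0<m , ordinaryGenerators m ,
    ( applyUpTo⁺₁ (m +_) m (λ i<j _ → <⇒≢ (+-monoʳ-< m i<j))
    , (λ x → mk⇔ (Ordinary⊆generated 0<m x)
                 (Generated-least Ordinary-isNumericalSemigroup
                   (λ _ → inj₂ ∘ proj₁ ∘ ordinaryGenerator-bounds) x))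
    , ordinaryGenerators-minimal 0<m )
    , length-applyUpTo (m +_) m

MEDClosure⊆Ordinary : ∀ {S m} → IsMultiplicity S m → MEDClosure S ⊆′ Ordinary m
MEDClosure⊆Ordinary {S} {m} multS@(_ , 0<m , least) x x∈MED =
  x∈MED (Ordinary m) Ordinary-isNumericalSemigroup (Ordinary-isMED 0<m) S⊆Ordinary
        (m , multS , Ordinary-multiplicity 0<m)
  where
  S⊆Ordinary : S ⊆′ Ordinary m
  S⊆Ordinary zero _ = inj₁ refl
  S⊆Ordinary (suc y) Sy = inj₂ (least (suc y) Sy z<s)

module _ {S : Subset} {u : ℕ} where

  S⊆Adjoin : S ⊆′ Adjoin S u
  S⊆Adjoin _ = gen-inj ∘ inj₁

  Adjoin-least : ∀ {T} → IsNumericalSemigroup T → S ⊆′ T → T u → Adjoin S u ⊆′ T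
  Adjoin-least nsT S⊆T Tu = Generated-least nsT λ { y (inj₁ Sy) → S⊆T y Sy ; _ (inj₂ refl) → Tu }

  multiplicity-Adjoin : IsNumericalSemigroup S → MEDClosure S u →
                        ∀ {m} → IsMultiplicity (Adjoin S u) m → ¬ ¬ IsMultiplicity S m
  multiplicity-Adjoin nsS u∈MED multSu@(Su-m , 0<m , least) ¬multS
    with least∈generators Su-m 0<m least
  ... | inj₁ Sm = ¬multS (IsMultiplicity-⊆ S⊆Adjoin Sm multSu)
  ... | inj₂ refl with N , cofinite ← IsNumericalSemigroup.cofinite nsS =
    ¬¬-multiplicity (cofinite (suc N) (n≤1+n N)) z<s λ (j , multS@(Sj , 0<j , _)) →
      [ (λ u≡0 → <⇒≢ 0<m (sym u≡0))
      , (λ j≤u → ¬multS (subst (IsMultiplicity S)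
                           (≤-antisym j≤u (least j (S⊆Adjoin j Sj) 0<j)) multS))
      ] (MEDClosure⊆Ordinary multS u u∈MED)

  MEDClosure-Adjoin⊆MEDClosure : MEDClosure S u → MEDClosure (Adjoin S u) ⊆′ MEDClosure S
  MEDClosure-Adjoin⊆MEDClosure u∈MED x x∈MED T nsT medT S⊆T (m , multS , multT) =
    x∈MED T nsT medT Adjoin⊆T (m , IsMultiplicity-⊆ Adjoin⊆T (S⊆Adjoin m (proj₁ multS)) multT , multT)
    where
    Adjoin⊆T : Adjoin S u ⊆′ T
    Adjoin⊆T = Adjoin-least nsT S⊆T (u∈MED T nsT medT S⊆T (m , multS , multT))

  MEDClosure⊆MEDClosure-Adjoin : IsNumericalSemigroup S → MEDClosure S u →
                                 MEDClosure S ⊆′ MEDClosure (Adjoin S u)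
  MEDClosure⊆MEDClosure-Adjoin nsS u∈MED x x∈MED T nsT medT Su⊆T (m , multSu , multT) =
    decidable-stable (IsMED-dec medT x)
      (¬¬-map (λ multS → x∈MED T nsT medT (λ y → Su⊆T y ∘ S⊆Adjoin y) (m , multS , multT))
              (multiplicity-Adjoin nsS u∈MED multSu))

mainTheorem2 : (S : ℕ → Set) → IsNumericalSemigroup S → (u : ℕ) → MEDClosure S u
    → ∀ x → MEDClosure (Adjoin S u) x ⇔ MEDClosure S x
mainTheorem2 S nsS u u∈MED x =
  mk⇔ (MEDClosure-Adjoin⊆MEDClosure u∈MED x) (MEDClosure⊆MEDClosure-Adjoin nsS u∈MED x)
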